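{- For $m\in\mathbb{N}$, the number of distinct distance magic labelings of the labeled graph $m\cdot C_4$ (the disjoint union of $m$ copies of the $4$-cycle, with labeled vertices) is $2^{2m}(2m)!$.
   Context: All graphs are finite, simple and undirected. For $u\in V(G)$, $N(u)$ is its (open) neighbourhood. For a graph $G$ of order $n\ge3$, a distance magic labeling (DML) is a bijection $f:V(G)\to\{1,\dots,n\}$ such that $\sum_{w\in N(u)} f(w)$ is a constant independent of $u\in V(G)$. Two labelings are distinct if they differ as functions on the (fixed, labeled) vertex set. -}

module Defs where

open import Data.Nat using (ℕ; zero; suc; _+_; _*_; _≤_)
open import Data.Fin using (Fin; zero; suc)
open import Data.Bool using (Bool; true; false; if_then_else_; _∧_)
open import Data.Vec using (Vec; lookup)
open import Data.Product using (Σ; _×_; _,_; ∃)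
open import Data.List using (List; map; allFin; length)
open import Data.Nat.ListAction using (sum)
open import Data.List.Membership.Propositional using (_∈_)
open import Data.List.Relation.Unary.Unique.Propositional using (Unique)
open import Relation.Binary.PropositionalEquality using (_≡_)
open import Relation.Nullary.Decidable using (⌊_⌋)
open import Function.Bundles using (_⇔_)
import Data.Fin as F

Vertex : ℕ → Set
Vertex m = Fin m × Fin 4

c4adj : Fin 4 → Fin 4 → Bool
c4adj zero (suc zero) = true
c4adj zero (suc (suc (suc zero))) = true
c4adj (suc zero) zero = true
c4adj (suc zero) (suc (suc zero)) = true
c4adj (suc (suc zero)) (suc zero) = true
c4adj (suc (suc zero)) (suc (suc (suc zero))) = true
c4adj (suc (suc (suc zero))) (suc (suc zero)) = true
c4adj (suc (suc (suc zero))) zero = true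
c4adj _ _ = false

adj : ∀ {m} → Vertex m → Vertex m → Bool
adj (i , j) (i' , j') = ⌊ i F.≟ i' ⌋ ∧ c4adj j j'

-- A labeling of the (labeled) vertex set: the label of (i , j) is lookup (lookup L i) j.
-- Represented as a vector so that distinct labelings = distinct functions on V.
Labeling : ℕ → Set
Labeling m = Vec (Vec ℕ 4) m

label : ∀ {m} → Labeling m → Vertex m → ℕ
label L (i , j) = lookup (lookup L i) j

nbSum : ∀ {m} → Labeling m → Vertex m → ℕ
nbSum {m} L u =
  sum (map (λ i → sum (map (λ j → if adj u (i , j) then label L (i , j) else 0) (allFin 4))) (allFin m))

IsBijLabeling : ∀ m → Labeling m → Set
IsBijLabeling m L =
  (∀ u → 1 ≤ label L u × label L u ≤ 4 * m)
  × (∀ u v → label L u ≡ label L v → u ≡ v)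
  × (∀ k → 1 ≤ k → k ≤ 4 * m → ∃ λ u → label L u ≡ k)

IsDML : ∀ m → Labeling m → Set
IsDML m L = IsBijLabeling m L × ∃ λ k → ∀ u → nbSum L u ≡ k

HasCount : ∀ m → (Labeling m → Set) → ℕ → Set
HasCount m P N = Σ (List (Labeling m)) λ l → Unique l × (∀ L → (L ∈ l) ⇔ P L) × length l ≡ N

-- In every copy of C₄ the two neighbours of a vertex are opposite each other,
-- so a labeling is distance magic with constant k iff opposite labels sum to k
-- in every copy. Since 1 and 4m must both be labels, k = 4m + 1, so a distance
-- magic labeling is a bijection onto {1, …, 4m} whose copies have the shape
-- (a, b, N − a, N − b) with N = 4m + 1. Choosing the copies one at a time
-- from the remaining labels, which stay closed under x ↦ N − x, leaves
-- 4j · (4j − 2) choices for a copy when 4j labels remain; the product of these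
-- numbers is 2^(2m) (2m)!.
module Submission where

open import Defs
open import Data.Nat using (ℕ; zero; suc; _+_; _*_; _∸_; _^_; _!; _≤_; z≤n; s≤s; _≟_)
open import Data.Nat.Properties
open import Data.Nat.ListAction using (sum)
open import Data.Nat.Tactic.RingSolver using (solve-∀)
open import Data.Bool using (if_then_else_)
open import Data.Fin using (Fin; zero; suc)
import Data.Fin as Fin
import Data.Fin.Properties as Fin
open import Data.Vec using (Vec; []; _∷_; lookup)
open import Data.Vec.Properties using (∷-injectiveʳ)
open import Data.List using (List; []; _∷_; _++_; map; length; allFin; tabulate; concatMap; filter; applyUpTo)
open import Data.List.Properties using (length-++; length-map; length-applyUpTo; map-tabulate; filter-all; filter-accept; filter-reject)
open import Data.List.Membership.Propositional using (_∈_; find; lose)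
open import Data.List.Membership.Propositional.Properties
  using (∈-concatMap⁺; ∈-concatMap⁻; ∈-map⁺; ∈-map⁻; ∈-filter⁺; ∈-filter⁻; ∈-applyUpTo⁺; ∈-applyUpTo⁻)
open import Data.List.Relation.Unary.Any using (here; there)
import Data.List.Relation.Unary.All as All
open import Data.List.Relation.Unary.AllPairs using ([]; _∷_)
open import Data.List.Relation.Unary.Unique.Propositional using (Unique)
import Data.List.Relation.Unary.Unique.Propositional.Properties as Unique
open import Data.Product using (_×_; _,_; ∃; ∃₂; proj₁; proj₂)
open import Data.Empty using (⊥-elim)
open import Relation.Nullary using (¬_; Dec; yes; no; ¬?)
open import Relation.Binary.PropositionalEquality
open import Function using (id; _∘_)
open import Function.Bundles using (_⇔_; mk⇔; Equivalence)
open import Function.Properties.Equivalence using () renaming (sym to ⇔-sym; trans to ⇔-trans)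

module _ {A B : Set} (f : A → List B) where

  ∈-concatMap-∃⁻ : ∀ {xs y} → y ∈ concatMap f xs → ∃ λ x → x ∈ xs × y ∈ f x
  ∈-concatMap-∃⁻ p = find (∈-concatMap⁻ f p)

  ∈-concatMap-∃⁺ : ∀ {xs x y} → x ∈ xs → y ∈ f x → y ∈ concatMap f xs
  ∈-concatMap-∃⁺ x∈ y∈ = ∈-concatMap⁺ f (lose x∈ y∈)

  length-concatMap-const : ∀ xs c → (∀ {x} → x ∈ xs → length (f x) ≡ c) →
                           length (concatMap f xs) ≡ length xs * c
  length-concatMap-const []       c const = refl
  length-concatMap-const (x ∷ xs) c const = begin
    length (f x ++ concatMap f xs)           ≡⟨ length-++ (f x) ⟩
    length (f x) + length (concatMap f xs)   ≡⟨ cong₂ _+_ (const (here refl))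
                                                   (length-concatMap-const xs c (const ∘ there)) ⟩
    c + length xs * c                        ∎
    where open ≡-Reasoning

  concatMap-unique : (key : B → A) → ∀ {xs} → Unique xs → (∀ {x} → x ∈ xs → Unique (f x)) →
                     (∀ {x y} → y ∈ f x → key y ≡ x) → Unique (concatMap f xs)
  concatMap-unique key {[]}     []          uniq key-inv = []
  concatMap-unique key {x ∷ xs} (x∉xs ∷ xs-unique) uniq key-inv =
    Unique.++⁺ (uniq (here refl)) (concatMap-unique key xs-unique (λ p → uniq (there p)) key-inv) disjoint
    where
    disjoint : ∀ {y} → ¬ (y ∈ f x × y ∈ concatMap f xs)
    disjoint (y∈fx , y∈rest) with x′ , x′∈ , y∈fx′ ← ∈-concatMap-∃⁻ y∈rest =
      All.lookup x∉xs x′∈ (trans (sym (key-inv y∈fx)) (key-inv y∈fx′))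

-- Opaque so that filter (and rowLabelings below) do not unfold in membership
-- goals: implicit arguments become uninferable and with-abstraction blows up.
opaque
  remove : ℕ → List ℕ → List ℕ
  remove x = filter (λ y → ¬? (y ≟ x))

  ∈-remove⁻ : ∀ {x y ys} → y ∈ remove x ys → y ∈ ys × y ≢ x
  ∈-remove⁻ {x} = ∈-filter⁻ (λ y → ¬? (y ≟ x))

  ∈-remove⁺ : ∀ {x y ys} → y ∈ ys → y ≢ x → y ∈ remove x ys
  ∈-remove⁺ {x} = ∈-filter⁺ (λ y → ¬? (y ≟ x))

  remove-unique : ∀ x {ys} → Unique ys → Unique (remove x ys)
  remove-unique x = Unique.filter⁺ (λ y → ¬? (y ≟ x))

  length-remove : ∀ {x ys} → Unique ys → x ∈ ys → length ys ≡ suc (length (remove x ys))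
  length-remove {x} {y ∷ ys} (y∉ys ∷ ys-unique) x∈ with y ≟ x | x∈
  ... | yes refl | _ = cong suc (sym (begin
    length (remove x (x ∷ ys))  ≡⟨ cong length (filter-reject keep (λ x≢x → x≢x refl)) ⟩
    length (remove x ys)        ≡⟨ cong length (filter-all keep (All.map (λ x≢z z≡x → x≢z (sym z≡x)) y∉ys)) ⟩
    length ys                   ∎))
    where
    open ≡-Reasoning
    keep : ∀ z → Dec (z ≢ x)
    keep z = ¬? (z ≟ x)
  ... | no y≢x | here x≡y   = ⊥-elim (y≢x (sym x≡y))
  ... | no y≢x | there x∈ys =
    trans (cong suc (length-remove ys-unique x∈ys)) (cong (suc ∘ length) (sym (filter-accept (λ z → ¬? (z ≟ x)) y≢x)))

labels : ℕ → List ℕ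
labels = applyUpTo suc

∈-labels⁺ : ∀ {n x} → 1 ≤ x → x ≤ n → x ∈ labels n
∈-labels⁺ {x = suc x} (s≤s _) x<n = ∈-applyUpTo⁺ suc x<n

∈-labels⁻ : ∀ {n x} → x ∈ labels n → 1 ≤ x × x ≤ n
∈-labels⁻ p with _ , i<n , refl ← ∈-applyUpTo⁻ suc p = s≤s z≤n , i<n

labels-unique : ∀ n → Unique (labels n)
labels-unique n = Unique.applyUpTo⁺₁ suc n (λ i<j _ → <⇒≢ i<j ∘ suc-injective)

length-labels : ∀ n → length (labels n) ≡ n
length-labels = length-applyUpTo suc

LabelInjective : ∀ {k} → Labeling k → Set
LabelInjective L = ∀ u v → label L u ≡ label L v → u ≡ v

record BijectsOnto {k} (S : List ℕ) (L : Labeling k) : Set where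
  field
    injective : LabelInjective L
    into      : ∀ u → label L u ∈ S
    onto      : ∀ s → s ∈ S → ∃ λ u → label L u ≡ s

module _ {k} {r : Vec ℕ 4} {L : Labeling k} where

  injective-∷ : (∀ j j′ → lookup r j ≡ lookup r j′ → j ≡ j′) → LabelInjective L →
                (∀ u j → label L u ≢ lookup r j) → LabelInjective (r ∷ L)
  injective-∷ r-inj L-inj avoid (zero  , j) (zero   , j′) e = cong (zero ,_) (r-inj j j′ e)
  injective-∷ r-inj L-inj avoid (zero  , j) (suc i  , j′) e = ⊥-elim (avoid (i , j′) j (sym e))
  injective-∷ r-inj L-inj avoid (suc i , j) (zero   , j′) e = ⊥-elim (avoid (i , j) j′ e)
  injective-∷ r-inj L-inj avoid (suc i , j) (suc i′ , j′) e with refl ← L-inj (i , j) (i′ , j′) e = refl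

  injective-tail : LabelInjective (r ∷ L) → LabelInjective L
  injective-tail inj (i , j) (i′ , j′) e with refl ← inj (suc i , j) (suc i′ , j′) e = refl

  injective-tail-avoids-head : LabelInjective (r ∷ L) → ∀ u j → label L u ≢ lookup r j
  injective-tail-avoids-head inj (i , j) j′ e with () ← inj (suc i , j) (zero , j′) e

sum-tabulate-zero : ∀ {n} (h : Fin n → ℕ) → (∀ i → h i ≡ 0) → sum (tabulate h) ≡ 0
sum-tabulate-zero {zero}  h h≡0 = refl
sum-tabulate-zero {suc n} h h≡0 = cong₂ _+_ (h≡0 zero) (sum-tabulate-zero (h ∘ suc) (h≡0 ∘ suc))

sum-tabulate-single : ∀ {n} (h : Fin n → ℕ) i → (∀ i′ → i ≢ i′ → h i′ ≡ 0) → sum (tabulate h) ≡ h i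
sum-tabulate-single h zero    vanish = begin
  h zero + sum (tabulate (h ∘ suc))  ≡⟨ cong (h zero +_) (sum-tabulate-zero (h ∘ suc) (λ i → vanish (suc i) (λ ()))) ⟩
  h zero + 0                         ≡⟨ +-identityʳ (h zero) ⟩
  h zero                             ∎
  where open ≡-Reasoning
sum-tabulate-single h (suc i) vanish = cong₂ _+_ (vanish zero (λ ()))
  (sum-tabulate-single (h ∘ suc) i (λ i′ i≢i′ → vanish (suc i′) (i≢i′ ∘ Fin.suc-injective)))

cycleNbSum : Vec ℕ 4 → Fin 4 → ℕ
cycleNbSum r j = sum (map (λ j′ → if c4adj j j′ then lookup r j′ else 0) (allFin 4))

nbSum-copy : ∀ {m} (L : Labeling m) i j → nbSum L (i , j) ≡ cycleNbSum (lookup L i) j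
nbSum-copy {m} L i j = begin
  sum (map copySum (allFin m))  ≡⟨ cong sum (map-tabulate id copySum) ⟩
  sum (tabulate copySum)        ≡⟨ sum-tabulate-single copySum i other-copies ⟩
  copySum i                     ≡⟨ this-copy ⟩
  cycleNbSum (lookup L i) j     ∎
  where
  open ≡-Reasoning
  copySum : Fin m → ℕ
  copySum i′ = sum (map (λ j′ → if adj (i , j) (i′ , j′) then label L (i′ , j′) else 0) (allFin 4))
  other-copies : ∀ i′ → i ≢ i′ → copySum i′ ≡ 0
  other-copies i′ i≢i′ with i Fin.≟ i′
  ... | yes i≡i′ = ⊥-elim (i≢i′ i≡i′)
  ... | no _     = refl
  this-copy : copySum i ≡ cycleNbSum (lookup L i) j
  this-copy with i Fin.≟ i
  ... | yes _   = refl
  ... | no i≢i  = ⊥-elim (i≢i refl)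

next opposite : Fin 4 → Fin 4
next zero                   = suc zero
next (suc zero)             = suc (suc zero)
next (suc (suc zero))       = suc (suc (suc zero))
next (suc (suc (suc zero))) = zero
opposite zero                   = suc (suc zero)
opposite (suc zero)             = suc (suc (suc zero))
opposite (suc (suc zero))       = zero
opposite (suc (suc (suc zero))) = suc zero

cycleNbSum-next : ∀ r j → cycleNbSum r (next j) ≡ lookup r j + lookup r (opposite j)
cycleNbSum-next (a ∷ b ∷ c ∷ d ∷ []) zero                   = cong (a +_) (+-identityʳ c)
cycleNbSum-next (a ∷ b ∷ c ∷ d ∷ []) (suc zero)             = cong (b +_) (+-identityʳ d)
cycleNbSum-next (a ∷ b ∷ c ∷ d ∷ []) (suc (suc zero))       = trans (cong (a +_) (+-identityʳ c)) (+-comm a c)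
cycleNbSum-next (a ∷ b ∷ c ∷ d ∷ []) (suc (suc (suc zero))) = trans (cong (b +_) (+-identityʳ d)) (+-comm b d)

opposite-labels-sum : ∀ {m k} {L : Labeling m} → (∀ u → nbSum L u ≡ k) →
                      ∀ i j → label L (i , j) + label L (i , opposite j) ≡ k
opposite-labels-sum {k = k} {L} magic i j = begin
  label L (i , j) + label L (i , opposite j)  ≡⟨ cycleNbSum-next (lookup L i) j ⟨
  cycleNbSum (lookup L i) (next j)            ≡⟨ nbSum-copy L i (next j) ⟨
  nbSum L (i , next j)                        ≡⟨ magic (i , next j) ⟩
  k                                           ∎
  where open ≡-Reasoning

2^2k*[2k]!-suc : ∀ k → (4 + 4 * k) * ((2 + 4 * k) * (2 ^ (2 * k) * (2 * k) !)) ≡ 2 ^ (2 * suc k) * (2 * suc k) !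
2^2k*[2k]!-suc k = begin
  (4 + 4 * k) * ((2 + 4 * k) * (2 ^ (2 * k) * (2 * k) !))
    ≡⟨ expand k (2 ^ (2 * k)) ((2 * k) !) ⟩
  2 ^ (2 + 2 * k) * (2 + 2 * k) !
    ≡⟨ cong (λ n → 2 ^ n * n !) (*-suc 2 k) ⟨
  2 ^ (2 * suc k) * (2 * suc k) ! ∎
  where
  open ≡-Reasoning
  expand : ∀ k P Q → (4 + 4 * k) * ((2 + 4 * k) * (P * Q)) ≡ 2 * (2 * P) * ((2 + 2 * k) * ((1 + 2 * k) * Q))
  expand = solve-∀

module Complement (N : ℕ) (N-odd : ∀ x → 2 * x ≢ N) where

  complement-involutive : ∀ {x} → x ≤ N → N ∸ (N ∸ x) ≡ x
  complement-involutive = m∸[m∸n]≡n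

  complement-injective : ∀ {x y} → x ≤ N → y ≤ N → N ∸ x ≡ N ∸ y → x ≡ y
  complement-injective {x} {y} x≤N y≤N e = begin
    x            ≡⟨ complement-involutive x≤N ⟨
    N ∸ (N ∸ x)  ≡⟨ cong (N ∸_) e ⟩
    N ∸ (N ∸ y)  ≡⟨ complement-involutive y≤N ⟩
    y            ∎
    where open ≡-Reasoning

  complement-no-fixpoint : ∀ {x} → x ≤ N → N ∸ x ≢ x
  complement-no-fixpoint {x} x≤N e = N-odd x (begin
    x + (x + 0)  ≡⟨ cong (x +_) (+-identityʳ x) ⟩
    x + x        ≡⟨ cong (x +_) e ⟨
    x + (N ∸ x)  ≡⟨ m+[n∸m]≡n x≤N ⟩
    N            ∎)
    where open ≡-Reasoning

  record Pool (S : List ℕ) : Set where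
    field
      unique  : Unique S
      bounded : ∀ {x} → x ∈ S → x ≤ N
      closed  : ∀ {x} → x ∈ S → N ∸ x ∈ S

  removePair : ℕ → List ℕ → List ℕ
  removePair a S = remove (N ∸ a) (remove a S)

  ∈-removePair⁻ : ∀ {a y S} → y ∈ removePair a S → y ∈ S × y ≢ a × y ≢ N ∸ a
  ∈-removePair⁻ p with y∈ , y≢a′ ← ∈-remove⁻ p with y∈S , y≢a ← ∈-remove⁻ y∈ = y∈S , y≢a , y≢a′

  ∈-removePair⁺ : ∀ {a y S} → y ∈ S → y ≢ a → y ≢ N ∸ a → y ∈ removePair a S
  ∈-removePair⁺ y∈S y≢a y≢a′ = ∈-remove⁺ (∈-remove⁺ y∈S y≢a) y≢a′

  removePair-unique : ∀ {a S} → Unique S → Unique (removePair a S)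
  removePair-unique {a} = remove-unique (N ∸ a) ∘ remove-unique a

  removePair-pool : ∀ {a S} → Pool S → a ∈ S → Pool (removePair a S)
  removePair-pool {a} {S} pool a∈S = record
    { unique  = removePair-unique unique
    ; bounded = bounded ∘ proj₁ ∘ ∈-removePair⁻
    ; closed  = closed′
    }
    where
    open Pool pool
    closed′ : ∀ {x} → x ∈ removePair a S → N ∸ x ∈ removePair a S
    closed′ x∈ with x∈S , x≢a , x≢a′ ← ∈-removePair⁻ x∈ =
      ∈-removePair⁺ (closed x∈S)
        (λ x′≡a → x≢a′ (trans (sym (complement-involutive (bounded x∈S))) (cong (N ∸_) x′≡a)))
        (x≢a ∘ complement-injective (bounded x∈S) (bounded a∈S))

  length-removePair : ∀ {a S} → Pool S → a ∈ S → length S ≡ 2 + length (removePair a S)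
  length-removePair {a} {S} pool a∈S = begin
    length S                           ≡⟨ length-remove unique a∈S ⟩
    suc (length (remove a S))          ≡⟨ cong suc (length-remove (remove-unique a unique) a′∈) ⟩
    2 + length (removePair a S)        ∎
    where
    open ≡-Reasoning
    open Pool pool
    a′∈ : N ∸ a ∈ remove a S
    a′∈ = ∈-remove⁺ (closed a∈S) (complement-no-fixpoint (bounded a∈S))

  removeRow : ℕ → ℕ → List ℕ → List ℕ
  removeRow a b S = removePair b (removePair a S)

  removeRow-pool : ∀ {a b S} → Pool S → a ∈ S → b ∈ removePair a S → Pool (removeRow a b S)
  removeRow-pool pool a∈S b∈ = removePair-pool (removePair-pool pool a∈S) b∈

  length-removeRow : ∀ {a b S k} → Pool S → a ∈ S → b ∈ removePair a S →
                     length S ≡ 4 * suc k → length (removeRow a b S) ≡ 4 * k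
  length-removeRow {a} {b} {S} {k} pool a∈S b∈ len = +-cancelˡ-≡ 4 _ _ (begin
    4 + length (removeRow a b S)  ≡⟨ cong (2 +_) (length-removePair (removePair-pool pool a∈S) b∈) ⟨
    2 + length (removePair a S)   ≡⟨ length-removePair pool a∈S ⟨
    length S                      ≡⟨ len ⟩
    4 * suc k                     ≡⟨ *-suc 4 k ⟩
    4 + 4 * k                     ∎)
    where open ≡-Reasoning

  row : ℕ → ℕ → Vec ℕ 4
  row a b = a ∷ b ∷ N ∸ a ∷ N ∸ b ∷ []

  RowForm : ∀ {k} → Labeling k → Set
  RowForm L = ∀ i → lookup L i ≡ row (label L (i , zero)) (label L (i , suc zero))

  complement-of-sum : ∀ {x y} → x + y ≡ N → y ≡ N ∸ x
  complement-of-sum {x} {y} e = trans (sym (m+n∸m≡n x y)) (cong (_∸ x) e)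

  row-of-opposite-sums : ∀ r → (∀ j → lookup r j + lookup r (opposite j) ≡ N) →
                         r ≡ row (lookup r zero) (lookup r (suc zero))
  row-of-opposite-sums (a ∷ b ∷ c ∷ d ∷ []) sums =
    cong₂ (λ c d → a ∷ b ∷ c ∷ d ∷ []) (complement-of-sum (sums zero)) (complement-of-sum (sums (suc zero)))

  plus-complement : ∀ {x} → x ≤ N → x + (N ∸ x + 0) ≡ N
  plus-complement {x} x≤N = trans (cong (x +_) (+-identityʳ (N ∸ x))) (m+[n∸m]≡n x≤N)

  cycleNbSum-row : ∀ {a b} → a ≤ N → b ≤ N → ∀ j → cycleNbSum (row a b) j ≡ N
  cycleNbSum-row a≤N b≤N zero                   = plus-complement b≤N
  cycleNbSum-row a≤N b≤N (suc zero)             = plus-complement a≤N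
  cycleNbSum-row a≤N b≤N (suc (suc zero))       = plus-complement b≤N
  cycleNbSum-row a≤N b≤N (suc (suc (suc zero))) = plus-complement a≤N

  rowForm-of-magic : ∀ {k} {L : Labeling k} → (∀ u → nbSum L u ≡ N) → RowForm L
  rowForm-of-magic {L = L} magic i = row-of-opposite-sums (lookup L i) (opposite-labels-sum {L = L} magic i)

  magic-of-rowForm : ∀ {k} {L : Labeling k} → RowForm L → (∀ u → label L u ≤ N) → ∀ u → nbSum L u ≡ N
  magic-of-rowForm {L = L} rowForm bounded (i , j) = begin
    nbSum L (i , j)                                             ≡⟨ nbSum-copy L i j ⟩
    cycleNbSum (lookup L i) j                                   ≡⟨ cong (λ r → cycleNbSum r j) (rowForm i) ⟩
    cycleNbSum (row (label L (i , zero)) (label L (i , suc zero))) j ≡⟨ cycleNbSum-row (bounded _) (bounded _) j ⟩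
    N                                                           ∎
    where open ≡-Reasoning

  module _ {a b} (a≤N : a ≤ N) (b≤N : b ≤ N) (b≢a : b ≢ a) (b≢a′ : b ≢ N ∸ a) where
    private
      a′≢a = complement-no-fixpoint a≤N
      b′≢b = complement-no-fixpoint b≤N
      a≢b′ : a ≢ N ∸ b
      a≢b′ a≡b′ = b≢a′ (trans (sym (complement-involutive b≤N)) (cong (N ∸_) (sym a≡b′)))

    row-injective : ∀ j j′ → lookup (row a b) j ≡ lookup (row a b) j′ → j ≡ j′
    row-injective zero                   zero                   _ = refl
    row-injective zero                   (suc zero)             e = ⊥-elim (b≢a (sym e))
    row-injective zero                   (suc (suc zero))       e = ⊥-elim (a′≢a (sym e))
    row-injective zero                   (suc (suc (suc zero))) e = ⊥-elim (a≢b′ e)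
    row-injective (suc zero)             zero                   e = ⊥-elim (b≢a e)
    row-injective (suc zero)             (suc zero)             _ = refl
    row-injective (suc zero)             (suc (suc zero))       e = ⊥-elim (b≢a′ e)
    row-injective (suc zero)             (suc (suc (suc zero))) e = ⊥-elim (b′≢b (sym e))
    row-injective (suc (suc zero))       zero                   e = ⊥-elim (a′≢a e)
    row-injective (suc (suc zero))       (suc zero)             e = ⊥-elim (b≢a′ (sym e))
    row-injective (suc (suc zero))       (suc (suc zero))       _ = refl
    row-injective (suc (suc zero))       (suc (suc (suc zero))) e = ⊥-elim (b≢a (sym (complement-injective a≤N b≤N e)))
    row-injective (suc (suc (suc zero))) zero                   e = ⊥-elim (a≢b′ (sym e))
    row-injective (suc (suc (suc zero))) (suc zero)             e = ⊥-elim (b′≢b e)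
    row-injective (suc (suc (suc zero))) (suc (suc zero))       e = ⊥-elim (b≢a (complement-injective b≤N a≤N e))
    row-injective (suc (suc (suc zero))) (suc (suc (suc zero))) _ = refl

  module _ {S a b k} {L : Labeling k} (pool : Pool S) (a∈S : a ∈ S) (b∈ : b ∈ removePair a S)
           (rest : BijectsOnto (removeRow a b S) L) where
    open Pool pool
    open BijectsOnto rest

    private
      removeRow⁻ : ∀ {x} → x ∈ removeRow a b S → (x ∈ S × x ≢ a × x ≢ N ∸ a) × x ≢ b × x ≢ N ∸ b
      removeRow⁻ x∈ with x∈′ , x≢b , x≢b′ ← ∈-removePair⁻ x∈ =
        ∈-removePair⁻ x∈′ , x≢b , x≢b′
      b∈S = proj₁ (∈-removePair⁻ b∈)

    injective-row-∷ : LabelInjective (row a b ∷ L)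
    injective-row-∷ with _ , b≢a , b≢a′ ← ∈-removePair⁻ b∈ =
      injective-∷ (row-injective (bounded a∈S) (bounded b∈S) b≢a b≢a′) injective avoid
      where
      avoid : ∀ u j → label L u ≢ lookup (row a b) j
      avoid u j e
        with (_ , x≢a , x≢a′) , x≢b , x≢b′ ← removeRow⁻ (into u)
        with j
      ... | zero                   = x≢a e
      ... | suc zero               = x≢b e
      ... | suc (suc zero)         = x≢a′ e
      ... | suc (suc (suc zero))   = x≢b′ e

    into-row-∷ : ∀ u → label (row a b ∷ L) u ∈ S
    into-row-∷ (zero , zero)                   = a∈S
    into-row-∷ (zero , suc zero)               = b∈S
    into-row-∷ (zero , suc (suc zero))         = closed a∈S
    into-row-∷ (zero , suc (suc (suc zero)))   = closed b∈S
    into-row-∷ (suc i , j) = proj₁ (proj₁ (removeRow⁻ (into (i , j))))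

    onto-row-∷ : ∀ s → s ∈ S → ∃ λ u → label (row a b ∷ L) u ≡ s
    onto-row-∷ s s∈S with s ≟ a | s ≟ N ∸ a | s ≟ b | s ≟ N ∸ b
    ... | yes refl | _        | _        | _        = (zero , zero) , refl
    ... | no _     | yes refl | _        | _        = (zero , suc (suc zero)) , refl
    ... | no _     | no _     | yes refl | _        = (zero , suc zero) , refl
    ... | no _     | no _     | no _     | yes refl = (zero , suc (suc (suc zero))) , refl
    ... | no s≢a   | no s≢a′  | no s≢b   | no s≢b′
      with (i , j) , e ← onto s (∈-removePair⁺ (∈-removePair⁺ s∈S s≢a s≢a′) s≢b s≢b′)
      = (suc i , j) , e

    bijectsOnto-row-∷ : BijectsOnto S (row a b ∷ L)
    bijectsOnto-row-∷ = record { injective = injective-row-∷ ; into = into-row-∷ ; onto = onto-row-∷ }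

  opaque
    rowLabelings : (k : ℕ) → List ℕ → List (Labeling k)
    rowLabelings zero    S = [] ∷ []
    rowLabelings (suc k) S =
      concatMap (λ a → concatMap (λ b → map (row a b ∷_) (rowLabelings k (removeRow a b S))) (removePair a S)) S

    ∈-rowLabelings-suc⁻ : ∀ {k S} {L : Labeling (suc k)} → L ∈ rowLabelings (suc k) S →
                          ∃₂ λ a b → a ∈ S × b ∈ removePair a S ×
                                     ∃ λ L′ → L ≡ row a b ∷ L′ × L′ ∈ rowLabelings k (removeRow a b S)
    ∈-rowLabelings-suc⁻ p
      with a , a∈S , p′  ← ∈-concatMap-∃⁻ _ p
      with b , b∈ , p″   ← ∈-concatMap-∃⁻ _ p′
      with L′ , L′∈ , eq ← ∈-map⁻ _ p″
      = a , b , a∈S , b∈ , L′ , eq , L′∈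

    ∈-rowLabelings-suc⁺ : ∀ {k S a b} {L : Labeling k} → a ∈ S → b ∈ removePair a S →
                          L ∈ rowLabelings k (removeRow a b S) → row a b ∷ L ∈ rowLabelings (suc k) S
    ∈-rowLabelings-suc⁺ a∈S b∈ L∈ = ∈-concatMap-∃⁺ _ a∈S (∈-concatMap-∃⁺ _ b∈ (∈-map⁺ _ L∈))

    ∈-rowLabelings-zero : ∀ {S} → [] ∈ rowLabelings zero S
    ∈-rowLabelings-zero = here refl

    rowLabelings-unique : ∀ k {S} → Unique S → Unique (rowLabelings k S)
    rowLabelings-unique zero    _        = All.[] ∷ []
    rowLabelings-unique (suc k) {S} S-unique =
      concatMap-unique _ (λ L → label L (zero , zero)) S-unique
        (λ _ → concatMap-unique _ (λ L → label L (zero , suc zero)) (removePair-unique S-unique)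
          (λ _ → Unique.map⁺ ∷-injectiveʳ
                   (rowLabelings-unique k (removePair-unique (removePair-unique S-unique))))
          second-label)
        first-label
      where
      second-label : ∀ {a b S L} → L ∈ map (row a b ∷_) (rowLabelings k S) → label L (zero , suc zero) ≡ b
      second-label {a} {b} p with _ , _ , refl ← ∈-map⁻ (row a b ∷_) p = refl
      first-label : ∀ {a L} →
                    L ∈ concatMap (λ b → map (row a b ∷_) (rowLabelings k (removeRow a b S))) (removePair a S) →
                    label L (zero , zero) ≡ a
      first-label {a} p
        with b , _ , p′ ← ∈-concatMap-∃⁻ (λ b → map (row a b ∷_) (rowLabelings k (removeRow a b S))) {removePair a S} p
        with _ , _ , refl ← ∈-map⁻ (row a b ∷_) p′ = refl

    length-rowLabelings : ∀ k {S} → Pool S → length S ≡ 4 * k →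
                          length (rowLabelings k S) ≡ 2 ^ (2 * k) * (2 * k) !
    length-rowLabelings zero    pool len = refl
    length-rowLabelings (suc k) {S} pool len = begin
      length (rowLabelings (suc k) S)        ≡⟨ length-concatMap-const _ S _ choices-after-a ⟩
      length S * ((2 + 4 * k) * count k)     ≡⟨ cong (_* _) (trans len (*-suc 4 k)) ⟩
      (4 + 4 * k) * ((2 + 4 * k) * count k)  ≡⟨ 2^2k*[2k]!-suc k ⟩
      count (suc k)                          ∎
      where
      open ≡-Reasoning
      count : ℕ → ℕ
      count j = 2 ^ (2 * j) * (2 * j) !
      length-removePair-4k : ∀ {a} → a ∈ S → length (removePair a S) ≡ 2 + 4 * k
      length-removePair-4k a∈S =
        +-cancelˡ-≡ 2 _ _ (trans (sym (length-removePair pool a∈S)) (trans len (*-suc 4 k)))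
      choices-after-a : ∀ {a} → a ∈ S →
        length (concatMap (λ b → map (row a b ∷_) (rowLabelings k (removeRow a b S))) (removePair a S))
          ≡ (2 + 4 * k) * count k
      choices-after-a {a} a∈S = begin
        _                                   ≡⟨ length-concatMap-const _ (removePair a S) _ choices-after-b ⟩
        length (removePair a S) * count k   ≡⟨ cong (_* count k) (length-removePair-4k a∈S) ⟩
        (2 + 4 * k) * count k               ∎
        where
        choices-after-b : ∀ {b} → b ∈ removePair a S →
                          length (map (row a b ∷_) (rowLabelings k (removeRow a b S))) ≡ count k
        choices-after-b b∈ = trans (length-map _ (rowLabelings k _))
          (length-rowLabelings k (removeRow-pool pool a∈S b∈) (length-removeRow pool a∈S b∈ len))

  ∈-rowLabelings⁻ : ∀ k {S} {L : Labeling k} → Pool S → length S ≡ 4 * k →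
                    L ∈ rowLabelings k S → RowForm L × BijectsOnto S L
  ∈-rowLabelings⁻ zero {[]} {[]} _ _ _ =
    (λ ()) , record { injective = λ () ; into = λ () ; onto = λ _ () }
  ∈-rowLabelings⁻ (suc k) pool len L∈
    with a , b , a∈S , b∈ , L′ , refl , L′∈ ← ∈-rowLabelings-suc⁻ L∈
    with rowForm , bijects ← ∈-rowLabelings⁻ k (removeRow-pool pool a∈S b∈) (length-removeRow pool a∈S b∈ len) L′∈
    = (λ { zero → refl ; (suc i) → rowForm i }) , bijectsOnto-row-∷ pool a∈S b∈ bijects

  ∈-rowLabelings⁺ : ∀ k {S} {L : Labeling k} → RowForm L → LabelInjective L → (∀ u → label L u ∈ S) →
                    L ∈ rowLabelings k S
  ∈-rowLabelings⁺ zero    {L = []} _ _ _ = ∈-rowLabelings-zero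
  ∈-rowLabelings⁺ (suc k) {S} {r@(a ∷ b ∷ _ ∷ _ ∷ []) ∷ L} rowForm inj into with refl ← rowForm zero =
    ∈-rowLabelings-suc⁺ (into (zero , zero)) b∈
      (∈-rowLabelings⁺ k {L = L} (rowForm ∘ suc) (injective-tail inj) into-rest)
    where
    head-distinct : ∀ j j′ → j ≢ j′ → label (r ∷ L) (zero , j) ≢ label (r ∷ L) (zero , j′)
    head-distinct j j′ j≢j′ = j≢j′ ∘ cong proj₂ ∘ inj (zero , j) (zero , j′)
    b∈ : b ∈ removePair a S
    b∈ = ∈-removePair⁺ (into (zero , suc zero))
           (head-distinct (suc zero) zero (λ ())) (head-distinct (suc zero) (suc (suc zero)) (λ ()))
    into-rest : ∀ u → label L u ∈ removeRow a b S
    into-rest (i , j) = ∈-removePair⁺ (∈-removePair⁺ (into (suc i , j)) (avoids zero) (avoids (suc (suc zero))))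
                          (avoids (suc zero)) (avoids (suc (suc (suc zero))))
      where avoids = injective-tail-avoids-head inj (i , j)

  ∈-rowLabelings⇔ : ∀ k {S} {L : Labeling k} → Pool S → length S ≡ 4 * k →
                    (L ∈ rowLabelings k S) ⇔ (RowForm L × BijectsOnto S L)
  ∈-rowLabelings⇔ k pool len = mk⇔ (∈-rowLabelings⁻ k pool len)
    (λ (rowForm , bijects) → ∈-rowLabelings⁺ k rowForm (BijectsOnto.injective bijects) (BijectsOnto.into bijects))

module CopiesOfC4 (m : ℕ) where
  open Complement (suc (4 * m)) (λ x e → even≢odd x (2 * m) (trans e (cong suc (*-assoc 2 2 m)))) public

  labels-pool : Pool (labels (4 * m))
  labels-pool = record
    { unique  = labels-unique (4 * m)
    ; bounded = m≤n⇒m≤1+n ∘ proj₂ ∘ ∈-labels⁻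
    ; closed  = closed
    }
    where
    closed : ∀ {x} → x ∈ labels (4 * m) → suc (4 * m) ∸ x ∈ labels (4 * m)
    closed {zero}  x∈ with () ← proj₁ (∈-labels⁻ x∈)
    closed {suc x} x∈ = ∈-labels⁺ (m<n⇒0<n∸m (proj₂ (∈-labels⁻ x∈))) (m∸n≤m (4 * m) x)

  isBijLabeling⇔bijectsOnto : ∀ {L} → IsBijLabeling m L ⇔ BijectsOnto (labels (4 * m)) L
  isBijLabeling⇔bijectsOnto = mk⇔
    (λ (range , injective , onto) → record
      { injective = injective
      ; into      = λ u → ∈-labels⁺ (proj₁ (range u)) (proj₂ (range u))
      ; onto      = λ s s∈ → onto s (proj₁ (∈-labels⁻ s∈)) (proj₂ (∈-labels⁻ s∈))
      })
    (λ bijects → let open BijectsOnto bijects in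
      ∈-labels⁻ ∘ into , injective , λ s 1≤s s≤4m → onto s (∈-labels⁺ 1≤s s≤4m))

  magic-constant : ∀ {L k} → 1 ≤ m → IsBijLabeling m L → (∀ u → nbSum L u ≡ k) → k ≡ suc (4 * m)
  magic-constant {L} {k} 1≤m (range , _ , onto) magic = ≤-antisym k≤1+4m 1+4m≤k
    where
    open ≤-Reasoning
    1≤4m : 1 ≤ 4 * m
    1≤4m = ≤-trans 1≤m (m≤n*m m 4)
    partner-sum : ∀ i j → label L (i , j) + label L (i , opposite j) ≡ k
    partner-sum = opposite-labels-sum {L = L} magic
    k≤1+4m : k ≤ suc (4 * m)
    k≤1+4m with (i , j) , labelled-1 ← onto 1 ≤-refl 1≤4m = begin
      k                                       ≡⟨ partner-sum i j ⟨
      label L (i , j) + label L (i , opposite j)  ≡⟨ cong (_+ label L (i , opposite j)) labelled-1 ⟩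
      1 + label L (i , opposite j)            ≤⟨ s≤s (proj₂ (range _)) ⟩
      suc (4 * m)                             ∎
    1+4m≤k : suc (4 * m) ≤ k
    1+4m≤k with (i , j) , labelled-4m ← onto (4 * m) 1≤4m ≤-refl = begin
      suc (4 * m)                             ≡⟨ +-comm 1 (4 * m) ⟩
      4 * m + 1                               ≤⟨ +-monoʳ-≤ (4 * m) (proj₁ (range _)) ⟩
      4 * m + label L (i , opposite j)        ≡⟨ cong (_+ label L (i , opposite j)) labelled-4m ⟨
      label L (i , j) + label L (i , opposite j)  ≡⟨ partner-sum i j ⟩
      k                                       ∎

  isDML⇔ : ∀ {L} → 1 ≤ m → IsDML m L ⇔ (RowForm L × BijectsOnto (labels (4 * m)) L)
  isDML⇔ {L} 1≤m = mk⇔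
    (λ (bij , k , magic) → rowForm-of-magic {L = L} (λ u → trans (magic u) (magic-constant {L} 1≤m bij magic)) ,
                           Equivalence.to isBijLabeling⇔bijectsOnto bij)
    (λ (rowForm , bijects) → Equivalence.from isBijLabeling⇔bijectsOnto bijects ,
                             suc (4 * m) , magic-of-rowForm {L = L} rowForm (Pool.bounded labels-pool ∘ BijectsOnto.into bijects))

corollary2p5 : ∀ (m : ℕ) → 1 ≤ m → HasCount m (IsDML m) (2 ^ (2 * m) * (2 * m) !)
corollary2p5 m 1≤m =
  rowLabelings m (labels (4 * m)) ,
  rowLabelings-unique m (labels-unique (4 * m)) ,
  (λ L → ⇔-trans (∈-rowLabelings⇔ m labels-pool (length-labels (4 * m))) (⇔-sym (isDML⇔ 1≤m))) ,
  length-rowLabelings m labels-pool (length-labels (4 * m))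
  where open CopiesOfC4 m
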